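{- Let $n,m\in\mathbb{N}$ with $\lfloor n\phi\rfloor=\lfloor (n-1)\phi\rfloor+1=\lfloor m(\phi+1)\rfloor+2$. Let $(x,y)\in\mathbb{Z}_{\geq0}^2$ with $(x,y)\notin P_1$ and $y=\lfloor n\phi\rfloor$ or $y=\lfloor n\phi\rfloor-1$. Then some position reachable from $(x,y)$ in one queen move lies in $P_1$.
   Context: $\phi=\frac{1+\sqrt5}2$; $\mathbb{N}$ is the positive integers. Queen moves from $(x,y)$: to $(u,y)$ with $0\le u<x$, to $(x,v)$ with $0\le v<y$, or to $(x-t,y-t)$ with $1\le t\le\min(x,y)$. $g:\mathbb{Z}_{\geq0}\to\{0,1\}$ is defined by $g(0)=1$, $g(1)=0$ and, for $k\ge2$, $g(k)=1-g(j)$ if there is $j\in\mathbb{Z}_{\geq0}$ with $\lfloor k\phi\rfloor=\lfloor j(\phi+1)\rfloor+1$, and $g(k)=1$ otherwise. $P_1=\{(\lfloor k\phi\rfloor+g(k)-1,\lfloor k(\phi+1)\rfloor+g(k)):k\ge0\}\cup\{(\lfloor k(\phi+1)\rfloor+g(k),\lfloor k\phi\rfloor+g(k)-1):k\ge0\}\cup\{(0,0),(1,1)\}$. -}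

module Defs where

open import Data.Nat using (ℕ; zero; suc; _+_; _*_; _∸_; _≤_; _<_; _≤ᵇ_; _≡ᵇ_; _/_)
open import Data.Bool using (Bool; true; false; if_then_else_)
open import Data.Maybe using (Maybe; just; nothing)
open import Data.Product using (_×_; ∃)
open import Data.Sum using (_⊎_)
open import Relation.Binary.PropositionalEquality using (_≡_)

isqrt : ℕ → ℕ
isqrt zero = zero
isqrt (suc n) with isqrt n
... | r = if (suc r * suc r) ≤ᵇ suc n then suc r else r

-- ⌊kφ⌋ = ⌊(k + √(5k²))/2⌋ = ⌊(k + ⌊√(5k²)⌋)/2⌋
floorPhi : ℕ → ℕ
floorPhi k = (k + isqrt (5 * (k * k))) / 2

-- ⌊k(φ+1)⌋ = ⌊kφ⌋ + k
floorPhi1 : ℕ → ℕ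
floorPhi1 k = floorPhi k + k

search : ℕ → (ℕ → Bool) → Maybe ℕ
search zero p = nothing
search (suc b) p = if p b then just b else search b p

-- g with fuel. Any j with ⌊kφ⌋ = ⌊j(φ+1)⌋+1 satisfies j < k, and it is unique,
-- so searching j < k is exhaustive; fuel k+1 suffices.
gF : ℕ → ℕ → ℕ
gF zero _ = 1
gF (suc f) zero = 1
gF (suc f) (suc zero) = 0
gF (suc f) (suc (suc k')) with search (suc (suc k')) (λ j → floorPhi (suc (suc k')) ≡ᵇ (floorPhi1 j + 1))
... | just j = 1 ∸ gF f j
... | nothing = 1

g : ℕ → ℕ
g k = gF (suc k) k

InP1 : ℕ → ℕ → Set
InP1 x y =
  (x ≡ 0 × y ≡ 0)
  ⊎ (x ≡ 1 × y ≡ 1)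
  ⊎ (∃ λ k → x ≡ (floorPhi k + g k) ∸ 1 × y ≡ floorPhi1 k + g k)
  ⊎ (∃ λ k → x ≡ floorPhi1 k + g k × y ≡ (floorPhi k + g k) ∸ 1)

QueenMove : ℕ → ℕ → ℕ → ℕ → Set
QueenMove x y u v =
  (u < x × v ≡ y)
  ⊎ (u ≡ x × v < y)
  ⊎ (∃ λ t → 1 ≤ t × t ≤ x × t ≤ y × u ≡ x ∸ t × v ≡ y ∸ t)

{-# OPTIONS --safe #-}
-- Write a k = ⌊kφ⌋ and b k = ⌊k(φ+1)⌋ = a k + k.  The sequences a and b are complementary
-- Beatty sequences, and g k = 0 exactly when a k = b j + 1 with g j = 1; hence every x ≥ 0 is
-- A c = a c + g c − 1 for some c or B k = b k + g k for some k, A is non-decreasing and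
-- B k = A k + k + 1.  Take x < y.  If x = B k, move down to (B k , A k).  If x = A c, compare
-- d + 1 = y − x with c + 1 = B c − A c: when larger, move down to (A c , B c); when smaller,
-- d < c and the diagonal move by A c − A d lands on (A d , B d).  Positions with x > y are
-- symmetric, and (x , x) moves diagonally to (0 , 0).  Floors are computed through the integer
-- square root; the irrationality of √5 makes the Beatty comparisons strict.
module Submission where

open import Defs
open import Data.Bool using (Bool; true; false; T)
open import Data.Empty using (⊥-elim)
open import Data.Maybe using (just; nothing)
open import Data.Nat using (ℕ; zero; suc; compare; less; equal; greater; _+_; _*_; _∸_; _/_; _≤_; _<_; _≤′_; ≤′-refl; ≤′-step; _≤ᵇ_; _≡ᵇ_; z≤n; s≤s)
open import Data.Nat.Divisibility using (_∣_; divides)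
open import Data.Nat.DivMod using (m/n*n≤m; m*n/n≡m; /-monoˡ-≤)
open import Data.Nat.Induction using (<-wellFounded)
open import Data.Nat.Primality using (euclidsLemma; prime?)
open import Data.Nat.Properties
open import Algebra.Properties.CommutativeSemigroup +-commutativeSemigroup using (xy∙z≈xz∙y)
open import Data.Nat.Tactic.RingSolver using (solve-∀)
open import Data.Product using (_×_; ∃; _,_; proj₁; proj₂; map₂)
open import Data.Sum using (_⊎_; inj₁; inj₂; reduce)
open import Function.Base using (_∘_)
open import Function.Bundles using (_⇔_; mk⇔; Equivalence)
open import Function.Properties.Equivalence using (⇔-setoid)
open import Induction.WellFounded using (Acc; acc)
open import Level using (0ℓ)
open import Relation.Binary using (tri<; tri≈; tri>)
open import Relation.Binary.PropositionalEquality using (_≡_; _≢_; refl; sym; trans; cong; cong₂; subst; subst₂; module ≡-Reasoning)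
open import Relation.Binary.Reasoning.Setoid (⇔-setoid 0ℓ) as ⇔-Reasoning using ()
open import Relation.Nullary using (¬_; yes; no)
open import Relation.Nullary.Decidable using (from-yes)

open Equivalence using (to; from)

module _ {f : ℕ → ℕ} (f-≤-suc : ∀ k → f k ≤ f (suc k)) where

  stepwise-mono-≤ : ∀ {k l} → k ≤ l → f k ≤ f l
  stepwise-mono-≤ k≤l = go (≤⇒≤′ k≤l)
    where
    go : ∀ {k l} → k ≤′ l → f k ≤ f l
    go ≤′-refl = ≤-refl
    go (≤′-step k≤′l) = ≤-trans (go k≤′l) (f-≤-suc _)

module _ {f : ℕ → ℕ} (f-<-suc : ∀ k → f k < f (suc k)) where

  stepwise-mono-< : ∀ {k l} → k < l → f k < f l
  stepwise-mono-< k<l = <-≤-trans (f-<-suc _) (stepwise-mono-≤ (λ k → <⇒≤ (f-<-suc k)) k<l)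

  stepwise-injective : ∀ {k l} → f k ≡ f l → k ≡ l
  stepwise-injective {k} {l} fk≡fl with <-cmp k l
  ... | tri< k<l _ _ = ⊥-elim (<-irrefl fk≡fl (stepwise-mono-< k<l))
  ... | tri≈ _ k≡l _ = k≡l
  ... | tri> _ _ l<k = ⊥-elim (<-irrefl (sym fk≡fl) (stepwise-mono-< l<k))

  stepwise-inflationary : ∀ k → k ≤ f k
  stepwise-inflationary zero = z≤n
  stepwise-inflationary (suc k) = ≤-trans (s≤s (stepwise-inflationary k)) (f-<-suc k)

  stepwise-bracket : f 0 ≡ 0 → ∀ x → ∃ λ k → f k ≤ x × x < f (suc k)
  stepwise-bracket f0≡0 zero = 0 , ≤-reflexive f0≡0 , subst (_< f 1) f0≡0 (f-<-suc 0)
  stepwise-bracket f0≡0 (suc x) with stepwise-bracket f0≡0 x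
  ... | k , fk≤x , x<f[1+k] with m≤n⇒m<n∨m≡n x<f[1+k]
  ... | inj₁ 1+x<f[1+k] = k , m≤n⇒m≤1+n fk≤x , 1+x<f[1+k]
  ... | inj₂ 1+x≡f[1+k] = suc k , ≤-reflexive (sym 1+x≡f[1+k]) , subst (_< f (suc (suc k))) (sym 1+x≡f[1+k]) (f-<-suc (suc k))

galois-< : ∀ {n N} {h : ℕ → ℕ} → (∀ {r} → r ≤ n ⇔ h r ≤ N) → ∀ {c} → n < c ⇔ N < h c
galois-< r≤n⇔hr≤N = mk⇔
  (λ n<c → ≰⇒> λ hc≤N → <⇒≱ n<c (from r≤n⇔hr≤N hc≤N))
  (λ N<hc → ≰⇒> λ c≤n → <⇒≱ N<hc (to r≤n⇔hr≤N c≤n))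

/2-galois : ∀ {m n} → m ≤ n / 2 ⇔ m * 2 ≤ n
/2-galois {m} {n} = mk⇔
  (λ m≤n/2 → ≤-trans (*-monoˡ-≤ 2 m≤n/2) (m/n*n≤m n 2))
  (λ m*2≤n → subst (_≤ n / 2) (m*n/n≡m m 2) (/-monoˡ-≤ 2 m*2≤n))

square-reflects-< : ∀ {m n} → m * m < n * n → m < n
square-reflects-< mm<nn = ≰⇒> λ n≤m → <⇒≱ mm<nn (*-mono-≤ n≤m n≤m)

square-reflects-≤ : ∀ {m n} → m * m ≤ n * n → m ≤ n
square-reflects-≤ mm≤nn = ≮⇒≥ λ n<m → <⇒≱ (*-mono-< n<m n<m) mm≤nn

isqrt-bounds : ∀ N → isqrt N * isqrt N ≤ N × N < suc (isqrt N) * suc (isqrt N)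
isqrt-bounds zero = z≤n , s≤s z≤n
isqrt-bounds (suc N) with isqrt N | isqrt-bounds N
... | r | r*r≤N , N<[1+r]² with suc r * suc r ≤ᵇ suc N in r+1≤ᵇ
... | true = ≤ᵇ⇒≤ (suc r * suc r) (suc N) (subst T (sym r+1≤ᵇ) _) ,
             ≤-<-trans N<[1+r]² (*-mono-< (n<1+n (suc r)) (n<1+n (suc r)))
... | false = m≤n⇒m≤1+n r*r≤N , ≰⇒> λ [1+r]²≤1+N → subst T r+1≤ᵇ (≤⇒≤ᵇ [1+r]²≤1+N)

isqrt-galois : ∀ {r N} → r ≤ isqrt N ⇔ r * r ≤ N
isqrt-galois {r} {N} = mk⇔
  (λ r≤s → ≤-trans (*-mono-≤ r≤s r≤s) (proj₁ (isqrt-bounds N)))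
  (λ r*r≤N → ≤-pred (square-reflects-< (≤-<-trans r*r≤N (proj₂ (isqrt-bounds N)))))

5∣m*m⇒5∣m : ∀ {m} → 5 ∣ m * m → 5 ∣ m
5∣m*m⇒5∣m {m} = reduce ∘ euclidsLemma m m (from-yes (prime? 5))

root-of-5*square : ∀ {r j} → r * r ≡ 5 * (j * j) → ∃ λ q → r ≡ q * 5 × j * j ≡ 5 * (q * q)
root-of-5*square {r} {j} eq with 5∣m*m⇒5∣m {r} (divides (j * j) (trans eq (*-comm 5 (j * j))))
... | divides q refl = q , refl , *-cancelˡ-≡ (j * j) (5 * (q * q)) 5 (trans (sym eq) (square-of-5* q))
  where
  square-of-5* : ∀ q → q * 5 * (q * 5) ≡ 5 * (5 * (q * q))
  square-of-5* = solve-∀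

√5-irrational : ∀ {r j} → r * r ≡ 5 * (j * j) → j ≡ 0
√5-irrational {r} {j} = descend r j (<-wellFounded j)
  where
  descend : ∀ r j → Acc _<_ j → r * r ≡ 5 * (j * j) → j ≡ 0
  descend r zero _ _ = refl
  descend r (suc j) (acc smaller) eq with root-of-5*square {r} {suc j} eq
  ... | q , _ , eq′ with root-of-5*square {suc j} {q} eq′
  ... | zero , () , _
  ... | suc i , 1+j≡[1+i]*5 , eq″ =
    ⊥-elim (1+n≢0 (trans 1+j≡[1+i]*5 (cong (_* 5) (descend q (suc i) (smaller i<j) eq″))))
    where
    i<j : suc i < suc j
    i<j = subst (suc i <_) (sym 1+j≡[1+i]*5) (m<m*n (suc i) 5 (s≤s (s≤s z≤n)))

⌊_√5⌋ : ℕ → ℕ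
⌊ k √5⌋ = isqrt (5 * (k * k))

+-cancelˡ-<⇔ : ∀ m {n o} → m + n < m + o ⇔ n < o
+-cancelˡ-<⇔ m = mk⇔ (+-cancelˡ-< m _ _) (+-monoʳ-< m)

floorPhi<⇔ : ∀ m j → floorPhi m < m + j ⇔ 5 * (m * m) < (m + 2 * j) * (m + 2 * j)
floorPhi<⇔ m j = begin
  floorPhi m < m + j                      ≈⟨ galois-< /2-galois ⟩
  m + ⌊ m √5⌋ < (m + j) * 2               ≡⟨ cong (m + ⌊ m √5⌋ <_) (double m j) ⟩
  m + ⌊ m √5⌋ < m + (m + 2 * j)           ≈⟨ +-cancelˡ-<⇔ m ⟩
  ⌊ m √5⌋ < m + 2 * j                     ≈⟨ galois-< isqrt-galois ⟩
  5 * (m * m) < (m + 2 * j) * (m + 2 * j) ∎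
  where
  open ⇔-Reasoning
  double : ∀ m j → (m + j) * 2 ≡ m + (m + 2 * j)
  double = solve-∀

m+n≡o+p⇒m<p⇔o<n : ∀ {m n o p} → m + n ≡ o + p → m < p ⇔ o < n
m+n≡o+p⇒m<p⇔o<n {m} {n} {o} {p} eq = mk⇔
  (λ m<p → +-cancelʳ-< p o n (subst₂ _<_ eq (+-comm p n) (+-monoˡ-< n m<p)))
  (λ o<n → +-cancelʳ-< n m p (subst₂ _<_ (sym eq) (+-comm n p) (+-monoˡ-< p o<n)))

-- Multiplied by 4, both sides become polynomials in e and j once m * 2 is replaced by e + j.
sum-of-squares : ∀ {e j m} → e + j ≡ m * 2 →
                 e * e + (m + 2 * j) * (m + 2 * j) ≡ 5 * (m * m) + 5 * (j * j)
sum-of-squares {e} {j} {m} e+j≡2m = *-cancelˡ-≡ _ _ 4 (begin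
  4 * (e * e + (m + 2 * j) * (m + 2 * j))   ≡⟨ expand-lhs e j m ⟩
  4 * (e * e) + (m * 2 + 4 * j) * (m * 2 + 4 * j)
    ≡⟨ cong (λ t → 4 * (e * e) + (t + 4 * j) * (t + 4 * j)) (sym e+j≡2m) ⟩
  4 * (e * e) + (e + j + 4 * j) * (e + j + 4 * j) ≡⟨ identity e j ⟩
  5 * ((e + j) * (e + j)) + 20 * (j * j)    ≡⟨ cong (λ t → 5 * (t * t) + 20 * (j * j)) e+j≡2m ⟩
  5 * (m * 2 * (m * 2)) + 20 * (j * j)      ≡⟨ expand-rhs m j ⟩
  4 * (5 * (m * m) + 5 * (j * j))           ∎)
  where
  open ≡-Reasoning
  expand-lhs : ∀ e j m → 4 * (e * e + (m + 2 * j) * (m + 2 * j)) ≡ 4 * (e * e) + (m * 2 + 4 * j) * (m * 2 + 4 * j)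
  expand-lhs = solve-∀
  identity : ∀ e j → 4 * (e * e) + (e + j + 4 * j) * (e + j + 4 * j) ≡ 5 * ((e + j) * (e + j)) + 20 * (j * j)
  identity = solve-∀
  expand-rhs : ∀ m j → 5 * (m * 2 * (m * 2)) + 20 * (j * j) ≡ 4 * (5 * (m * m) + 5 * (j * j))
  expand-rhs = solve-∀

2m≤j⇒5m²<[m+2j]² : ∀ {m j} → 1 ≤ j → m * 2 ≤ j → 5 * (m * m) < (m + 2 * j) * (m + 2 * j)
2m≤j⇒5m²<[m+2j]² {m} {j} 1≤j 2m≤j = begin-strict
  5 * (m * m)                               ≡⟨ five m ⟩
  m * m + 4 * (m * m)                       ≤⟨ +-monoʳ-≤ (m * m) (*-monoʳ-≤ 4 (*-monoʳ-≤ m m≤j)) ⟩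
  m * m + 4 * (m * j)                       <⟨ m<m+n _ (≤-trans (s≤s z≤n) (*-monoʳ-≤ 4 (*-mono-≤ 1≤j 1≤j))) ⟩
  m * m + 4 * (m * j) + 4 * (j * j)         ≡⟨ square m j ⟩
  (m + 2 * j) * (m + 2 * j)                 ∎
  where
  open ≤-Reasoning
  m≤j : m ≤ j
  m≤j = ≤-trans (m≤m*n m 2) 2m≤j
  five : ∀ m → 5 * (m * m) ≡ m * m + 4 * (m * m)
  five = solve-∀
  square : ∀ m j → m * m + 4 * (m * j) + 4 * (j * j) ≡ (m + 2 * j) * (m + 2 * j)
  square = solve-∀

≤floorPhi⇔ : ∀ m j → 1 ≤ j → m ≤ floorPhi j ⇔ 5 * (m * m) < (m + 2 * j) * (m + 2 * j)
≤floorPhi⇔ m j 1≤j with m * 2 ≤? j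
... | yes 2m≤j = mk⇔ (λ _ → 2m≤j⇒5m²<[m+2j]² {m} 1≤j 2m≤j)
                     (λ _ → from /2-galois (≤-trans 2m≤j (m≤m+n j ⌊ j √5⌋)))
... | no 2m≰j = begin
  m ≤ floorPhi j                          ≈⟨ /2-galois ⟩
  m * 2 ≤ j + ⌊ j √5⌋                     ≡⟨ cong₂ _≤_ (sym e+j≡2m) (+-comm j ⌊ j √5⌋) ⟩
  e + j ≤ ⌊ j √5⌋ + j                     ≈⟨ mk⇔ (+-cancelʳ-≤ j e ⌊ j √5⌋) (+-monoˡ-≤ j) ⟩
  e ≤ ⌊ j √5⌋                             ≈⟨ isqrt-galois ⟩
  e * e ≤ 5 * (j * j)                     ≈⟨ mk⇔ (λ ee≤5jj → ≤∧≢⇒< ee≤5jj (j≢0 ∘ √5-irrational {e})) <⇒≤ ⟩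
  e * e < 5 * (j * j)                     ≈⟨ m+n≡o+p⇒m<p⇔o<n (sum-of-squares {e} {j} {m} e+j≡2m) ⟩
  5 * (m * m) < (m + 2 * j) * (m + 2 * j) ∎
  where
  open ⇔-Reasoning
  e = m * 2 ∸ j
  e+j≡2m : e + j ≡ m * 2
  e+j≡2m = m∸n+n≡m (<⇒≤ (≰⇒> 2m≰j))
  j≢0 : j ≢ 0
  j≢0 = >⇒≢ 1≤j

-- Both sides say m < jφ, i.e. 5m² < (m + 2j)².
≤floorPhi⇔floorPhi< : ∀ {m j} → 1 ≤ j → m ≤ floorPhi j ⇔ floorPhi m < m + j
≤floorPhi⇔floorPhi< {m} {j} 1≤j = begin
  m ≤ floorPhi j                          ≈⟨ ≤floorPhi⇔ m j 1≤j ⟩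
  5 * (m * m) < (m + 2 * j) * (m + 2 * j) ≈⟨ floorPhi<⇔ m j ⟨
  floorPhi m < m + j                      ∎
  where open ⇔-Reasoning

⌊√5⌋≤5* : ∀ k → ⌊ k √5⌋ ≤ 5 * k
⌊√5⌋≤5* k = square-reflects-≤ (begin
  ⌊ k √5⌋ * ⌊ k √5⌋   ≤⟨ proj₁ (isqrt-bounds (5 * (k * k))) ⟩
  5 * (k * k)         ≤⟨ m≤n*m (5 * (k * k)) 5 ⟩
  5 * (5 * (k * k))   ≡⟨ twenty-five k ⟩
  5 * k * (5 * k)     ∎)
  where
  open ≤-Reasoning
  twenty-five : ∀ k → 5 * (5 * (k * k)) ≡ 5 * k * (5 * k)
  twenty-five = solve-∀

⌊√5⌋-<-suc : ∀ k → ⌊ k √5⌋ < ⌊ suc k √5⌋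
⌊√5⌋-<-suc k = from isqrt-galois (begin
  suc s * suc s                     ≡⟨ expand s ⟩
  s * s + (2 * s + 1)               ≤⟨ +-mono-≤ (proj₁ (isqrt-bounds (5 * (k * k))))
                                                (+-monoˡ-≤ 1 (*-monoʳ-≤ 2 (⌊√5⌋≤5* k))) ⟩
  5 * (k * k) + (2 * (5 * k) + 1)   ≤⟨ m≤m+n _ 4 ⟩
  5 * (k * k) + (2 * (5 * k) + 1) + 4 ≡⟨ expand-5 k ⟩
  5 * (suc k * suc k)               ∎)
  where
  open ≤-Reasoning
  s = ⌊ k √5⌋
  expand : ∀ s → suc s * suc s ≡ s * s + (2 * s + 1)
  expand = solve-∀
  expand-5 : ∀ k → 5 * (k * k) + (2 * (5 * k) + 1) + 4 ≡ 5 * (suc k * suc k)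
  expand-5 = solve-∀

floorPhi-<-suc : ∀ k → floorPhi k < floorPhi (suc k)
floorPhi-<-suc k = from /2-galois (begin
  suc (floorPhi k) * 2        ≤⟨ +-monoʳ-≤ 2 (to /2-galois ≤-refl) ⟩
  2 + (k + ⌊ k √5⌋)           ≡⟨ cong suc (+-suc k ⌊ k √5⌋) ⟨
  suc k + suc ⌊ k √5⌋         ≤⟨ +-monoʳ-≤ (suc k) (⌊√5⌋-<-suc k) ⟩
  suc k + ⌊ suc k √5⌋         ∎)
  where open ≤-Reasoning

floorPhi-mono-≤ : ∀ {k l} → k ≤ l → floorPhi k ≤ floorPhi l
floorPhi-mono-≤ = stepwise-mono-≤ (λ k → <⇒≤ (floorPhi-<-suc k))

floorPhi1-skip : ∀ k → 2 + floorPhi1 k ≤ floorPhi1 (suc k)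
floorPhi1-skip k = subst (_≤ floorPhi1 (suc k)) (cong suc (+-suc (floorPhi k) k))
                         (+-monoˡ-≤ (suc k) (floorPhi-<-suc k))

floorPhi1-<-suc : ∀ k → floorPhi1 k < floorPhi1 (suc k)
floorPhi1-<-suc k = ≤-trans (n≤1+n _) (floorPhi1-skip k)

floorPhi1-mono-≤ : ∀ {k l} → k ≤ l → floorPhi1 k ≤ floorPhi1 l
floorPhi1-mono-≤ = stepwise-mono-≤ (λ k → <⇒≤ (floorPhi1-<-suc k))

floorPhi1-injective : ∀ {k l} → floorPhi1 k ≡ floorPhi1 l → k ≡ l
floorPhi1-injective = stepwise-injective floorPhi1-<-suc

floorPhi1≢suc-floorPhi1 : ∀ k l → floorPhi1 l ≢ suc (floorPhi1 k)
floorPhi1≢suc-floorPhi1 k l bl≡1+bk with l ≤? k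
... | yes l≤k = <⇒≱ (≤-reflexive (sym bl≡1+bk)) (floorPhi1-mono-≤ l≤k)
... | no l≰k = <⇒≱ (s≤s (≤-reflexive bl≡1+bk)) (≤-trans (floorPhi1-skip k) (floorPhi1-mono-≤ (≰⇒> l≰k)))

floorPhi1-fills-gap : ∀ {k j} → floorPhi k < k + j → k + j < floorPhi (suc k) → floorPhi j ≡ k
floorPhi1-fills-gap {k} {j} φk<k+j k+j<φ[1+k] = ≤-antisym
  (≮⇒≥ λ k<φj → <⇒≱ (to (≤floorPhi⇔floorPhi< 1≤j) k<φj) k+j<φ[1+k])
  (from (≤floorPhi⇔floorPhi< 1≤j) φk<k+j)
  where
  1≤j : 1 ≤ j
  1≤j = +-cancelˡ-≤ k 1 j (subst (_≤ k + j) (+-comm 1 k) (≤-<-trans (stepwise-inflationary floorPhi-<-suc k) φk<k+j))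

-- Opaque so that `with` on this lemma does not normalise its proof (the same for g-unfold,
-- A-mono-≤ and A-B-cover): normal forms of floorPhi (suc k) unfold isqrt exponentially.
opaque
  floorPhi-floorPhi1-cover : ∀ x → (∃ λ k → floorPhi k ≡ x) ⊎ (∃ λ j → floorPhi1 j ≡ x)
  floorPhi-floorPhi1-cover x with stepwise-bracket floorPhi-<-suc refl x
  ... | k , φk≤x , x<φ[1+k] with m≤n⇒m<n∨m≡n φk≤x
  ...   | inj₂ φk≡x = inj₁ (k , φk≡x)
  ...   | inj₁ φk<x with x ∸ k | m+[n∸m]≡n (≤-trans (stepwise-inflationary floorPhi-<-suc k) φk≤x)
  ...     | j | refl = inj₂ (j , cong (_+ j) (floorPhi1-fills-gap φk<x x<φ[1+k]))

matchesᵇ : ℕ → ℕ → Bool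
matchesᵇ k j = floorPhi k ≡ᵇ floorPhi1 j + 1

search-just : ∀ {n} p {j} → search n p ≡ just j → T (p j) × j < n
search-just {suc n} p eq with p n in pn
search-just {suc n} p refl | true = subst T (sym pn) _ , ≤-refl
search-just {suc n} p eq   | false = map₂ m≤n⇒m≤1+n (search-just p eq)

search-nothing : ∀ {n} p {j} → search n p ≡ nothing → j < n → ¬ T (p j)
search-nothing {suc n} p eq j<1+n with p n in pn
search-nothing {suc n} p () j<1+n | true
... | false with m≤n⇒m<n∨m≡n j<1+n
...   | inj₁ j<n = search-nothing p eq (≤-pred j<n)
...   | inj₂ refl = subst T pn

gF-fuel-irrelevant : ∀ f f′ k → k < f → k < f′ → gF f k ≡ gF f′ k
gF-fuel-irrelevant (suc f) (suc f′) zero _ _ = refl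
gF-fuel-irrelevant (suc f) (suc f′) (suc zero) _ _ = refl
gF-fuel-irrelevant (suc f) (suc f′) (suc (suc k)) (s≤s k<f) (s≤s k<f′)
  with search (suc (suc k)) (λ j → floorPhi (suc (suc k)) ≡ᵇ floorPhi1 j + 1) in eq
... | just j = cong (1 ∸_) (gF-fuel-irrelevant f f′ j (<-≤-trans j<2+k k<f) (<-≤-trans j<2+k k<f′))
  where
  j<2+k : j < suc (suc k)
  j<2+k = proj₂ (search-just (matchesᵇ (suc (suc k))) eq)
... | nothing = refl

floorPhi≡floorPhi1+1⇒< : ∀ {k j} → floorPhi k ≡ floorPhi1 j + 1 → j < k
floorPhi≡floorPhi1+1⇒< {k} {j} φk≡bj+1 = ≰⇒> λ k≤j → <⇒≱
  (subst (floorPhi1 j <_) (sym φk≡bj+1) (m<m+n (floorPhi1 j) (s≤s z≤n)))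
  (≤-trans (floorPhi-mono-≤ k≤j) (m≤m+n (floorPhi j) j))

opaque
  g-unfold : ∀ k →
    (∃ λ j → floorPhi (suc (suc k)) ≡ floorPhi1 j + 1 × g (suc (suc k)) ≡ 1 ∸ g j) ⊎
    ((∀ j → floorPhi (suc (suc k)) ≢ floorPhi1 j + 1) × g (suc (suc k)) ≡ 1)
  g-unfold k with search (suc (suc k)) (λ j → floorPhi (suc (suc k)) ≡ᵇ floorPhi1 j + 1) in eq
  ... | just j = inj₁ (j , ≡ᵇ⇒≡ _ _ j-matches , cong (1 ∸_) (gF-fuel-irrelevant _ _ j j<2+k ≤-refl))
    where
    j-matches : T (matchesᵇ (suc (suc k)) j)
    j-matches = proj₁ (search-just (matchesᵇ (suc (suc k))) eq)
    j<2+k : j < suc (suc k)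
    j<2+k = proj₂ (search-just (matchesᵇ (suc (suc k))) eq)
  ... | nothing = inj₂ (no-match , refl)
    where
    no-match : ∀ j → floorPhi (suc (suc k)) ≢ floorPhi1 j + 1
    no-match j φ≡bj+1 = search-nothing (matchesᵇ (suc (suc k))) eq
                          (floorPhi≡floorPhi1+1⇒< {j = j} φ≡bj+1) (≡⇒≡ᵇ _ _ φ≡bj+1)

g≤1 : ∀ k → g k ≤ 1
g≤1 zero = ≤-refl
g≤1 (suc zero) = z≤n
g≤1 (suc (suc k)) with g-unfold k
... | inj₁ (j , _ , g≡1∸gj) = ≤-trans (≤-reflexive g≡1∸gj) (m∸n≤m 1 (g j))
... | inj₂ (_ , g≡1) = ≤-reflexive g≡1

g-binary : ∀ k → g k ≡ 0 ⊎ g k ≡ 1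
g-binary k with g k | g≤1 k
... | zero     | _ = inj₁ refl
... | suc zero | _ = inj₂ refl
... | suc (suc _) | s≤s ()

-- The recursion defining g for k ≥ 2 also holds for k = 0 and k = 1 (where j = 0).
g-match : ∀ {k j} → floorPhi k ≡ floorPhi1 j + 1 → g k ≡ 1 ∸ g j
g-match {zero} {j} 0≡bj+1 = ⊥-elim (0≢1+n (trans 0≡bj+1 (+-comm (floorPhi1 j) 1)))
g-match {suc zero} {j} 1≡bj+1
  with floorPhi1-injective {j} {0} (+-cancelʳ-≡ 1 (floorPhi1 j) 0 (sym 1≡bj+1))
... | refl = refl
g-match {suc (suc k)} {j} φ≡bj+1 with g-unfold k
... | inj₁ (i , φ≡bi+1 , g≡1∸gi) =
  trans g≡1∸gi (cong (λ i → 1 ∸ g i) (floorPhi1-injective {i} {j} (+-cancelʳ-≡ 1 _ _ (trans (sym φ≡bi+1) φ≡bj+1))))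
... | inj₂ (no-match , _) = ⊥-elim (no-match j φ≡bj+1)

g≡0⇒match : ∀ {k} → g k ≡ 0 → ∃ λ j → floorPhi k ≡ floorPhi1 j + 1 × g j ≡ 1
g≡0⇒match {zero} ()
g≡0⇒match {suc zero} _ = 0 , refl , refl
g≡0⇒match {suc (suc k)} g≡0 with g-unfold k
... | inj₂ (_ , g≡1) = ⊥-elim (1+n≢0 (trans (sym g≡1) g≡0))
... | inj₁ (j , φ≡bj+1 , g≡1∸gj) with g-binary j
...   | inj₂ gj≡1 = j , φ≡bj+1 , gj≡1
...   | inj₁ gj≡0 = ⊥-elim (1+n≢0 (trans (cong (1 ∸_) (sym gj≡0)) (trans (sym g≡1∸gj) g≡0)))

-- P₁ = {(A k , B k) , (B k , A k) : k ≥ 0} ∪ {(0 , 0) , (1 , 1)}.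
A B : ℕ → ℕ
A k = floorPhi k + g k ∸ 1
B k = floorPhi1 k + g k

suc-A : ∀ k → suc (A k) ≡ floorPhi k + g k
suc-A zero = refl
suc-A (suc k) = m+[n∸m]≡n {1}
  (≤-trans (s≤s z≤n) (≤-trans (stepwise-inflationary floorPhi-<-suc (suc k)) (m≤m+n _ (g (suc k)))))

B≡suc[A+k] : ∀ k → B k ≡ suc (A k + k)
B≡suc[A+k] k = begin
  floorPhi k + k + g k   ≡⟨ xy∙z≈xz∙y (floorPhi k) k (g k) ⟩
  floorPhi k + g k + k   ≡⟨ cong (_+ k) (suc-A k) ⟨
  suc (A k) + k          ∎
  where open ≡-Reasoning

A-≤-suc : ∀ k → A k ≤ A (suc k)
A-≤-suc k = ≤-pred (begin
  suc (A k)                     ≡⟨ suc-A k ⟩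
  floorPhi k + g k              ≤⟨ +-monoʳ-≤ (floorPhi k) (g≤1 k) ⟩
  floorPhi k + 1                ≡⟨ +-comm (floorPhi k) 1 ⟩
  suc (floorPhi k)              ≤⟨ floorPhi-<-suc k ⟩
  floorPhi (suc k)              ≤⟨ m≤m+n (floorPhi (suc k)) (g (suc k)) ⟩
  floorPhi (suc k) + g (suc k)  ≡⟨ suc-A (suc k) ⟨
  suc (A (suc k))               ∎)
  where open ≤-Reasoning

opaque
  A-mono-≤ : ∀ {k l} → k ≤ l → A k ≤ A l
  A-mono-≤ = stepwise-mono-≤ A-≤-suc

  A-B-cover : ∀ x → (∃ λ c → A c ≡ x) ⊎ (∃ λ k → B k ≡ x)
  A-B-cover x with floorPhi-floorPhi1-cover x
  ... | inj₁ (k , φk≡x) with g-binary k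
  ...   | inj₂ gk≡1 = inj₁ (k , suc-injective (begin
    suc (A k)         ≡⟨ suc-A k ⟩
    floorPhi k + g k  ≡⟨ cong (floorPhi k +_) gk≡1 ⟩
    floorPhi k + 1    ≡⟨ +-comm (floorPhi k) 1 ⟩
    suc (floorPhi k)  ≡⟨ cong suc φk≡x ⟩
    suc x             ∎))
    where open ≡-Reasoning
  ...   | inj₁ gk≡0 with g≡0⇒match {k} gk≡0
  ...     | j , φk≡bj+1 , gj≡1 = inj₂ (j , trans (cong (floorPhi1 j +_) gj≡1) (trans (sym φk≡bj+1) φk≡x))
  A-B-cover x | inj₂ (k , bk≡x) with g-binary k
  ...   | inj₁ gk≡0 = inj₂ (k , trans (cong (floorPhi1 k +_) gk≡0) (trans (+-identityʳ _) bk≡x))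
  ...   | inj₂ gk≡1 with floorPhi-floorPhi1-cover (suc x)
  ...     | inj₂ (l , bl≡1+x) = ⊥-elim (floorPhi1≢suc-floorPhi1 k l (trans bl≡1+x (cong suc (sym bk≡x))))
  ...     | inj₁ (l , φl≡1+x) = inj₁ (l , suc-injective (begin
    suc (A l)         ≡⟨ suc-A l ⟩
    floorPhi l + g l  ≡⟨ cong (floorPhi l +_) gl≡0 ⟩
    floorPhi l + 0    ≡⟨ +-identityʳ (floorPhi l) ⟩
    floorPhi l        ≡⟨ φl≡1+x ⟩
    suc x             ∎))
    where
    open ≡-Reasoning
    gl≡0 : g l ≡ 0
    gl≡0 = trans (g-match {l} {k} (trans φl≡1+x (trans (cong suc (sym bk≡x)) (+-comm 1 (floorPhi1 k)))))
                 (cong (1 ∸_) gk≡1)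

A<B : ∀ k → A k < B k
A<B k = subst (A k <_) (sym (B≡suc[A+k] k)) (s≤s (m≤m+n (A k) k))

A,B∈P1 : ∀ k → InP1 (A k) (B k)
A,B∈P1 k = inj₂ (inj₂ (inj₁ (k , refl , refl)))

B,A∈P1 : ∀ k → InP1 (B k) (A k)
B,A∈P1 k = inj₂ (inj₂ (inj₂ (k , refl , refl)))

InP1-swap : ∀ {x y} → InP1 x y → InP1 y x
InP1-swap (inj₁ (x≡0 , y≡0)) = inj₁ (y≡0 , x≡0)
InP1-swap (inj₂ (inj₁ (x≡1 , y≡1))) = inj₂ (inj₁ (y≡1 , x≡1))
InP1-swap (inj₂ (inj₂ (inj₁ (k , x≡ , y≡)))) = inj₂ (inj₂ (inj₂ (k , y≡ , x≡)))
InP1-swap (inj₂ (inj₂ (inj₂ (k , x≡ , y≡)))) = inj₂ (inj₂ (inj₁ (k , y≡ , x≡)))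

QueenMove-swap : ∀ {x y u v} → QueenMove x y u v → QueenMove y x v u
QueenMove-swap (inj₁ (u<x , v≡y)) = inj₂ (inj₁ (v≡y , u<x))
QueenMove-swap (inj₂ (inj₁ (u≡x , v<y))) = inj₁ (v<y , u≡x)
QueenMove-swap (inj₂ (inj₂ (t , 1≤t , t≤x , t≤y , u≡ , v≡))) = inj₂ (inj₂ (t , 1≤t , t≤y , t≤x , v≡ , u≡))

MovesIntoP1 : ℕ → ℕ → Set
MovesIntoP1 x y = ∃ λ u → ∃ λ v → QueenMove x y u v × InP1 u v

MovesIntoP1-swap : ∀ {x y} → MovesIntoP1 x y → MovesIntoP1 y x
MovesIntoP1-swap (u , v , move , uv∈P1) = v , u , QueenMove-swap move , InP1-swap uv∈P1

move-down : ∀ {x y v} → v < y → InP1 x v → MovesIntoP1 x y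
move-down {x} {v = v} v<y xv∈P1 = x , v , inj₂ (inj₁ (refl , v<y)) , xv∈P1

move-diagonally : ∀ {u v} t → 1 ≤ t → InP1 u v → MovesIntoP1 (u + t) (v + t)
move-diagonally {u} {v} t 1≤t uv∈P1 =
  u , v , inj₂ (inj₂ (t , 1≤t , m≤n+m t u , m≤n+m t v , sym (m+n∸n≡m u t) , sym (m+n∸n≡m v t))) , uv∈P1

moves-from-A : ∀ c d → ¬ InP1 (A c) (suc (A c + d)) → MovesIntoP1 (A c) (suc (A c + d))
moves-from-A c d ∉P1 with compare d c
... | equal _ = ⊥-elim (∉P1 (subst (InP1 (A c)) (B≡suc[A+k] c) (A,B∈P1 c)))
... | greater _ k = move-down (subst (_< suc (A c + d)) (sym (B≡suc[A+k] c)) Ac+c<Ac+d) (A,B∈P1 c)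
  where
  Ac+c<Ac+d : suc (A c + c) < suc (A c + d)
  Ac+c<Ac+d = s≤s (+-monoʳ-< (A c) (s≤s (m≤m+n c k)))
... | less _ k with m≤n⇒m<n∨m≡n (A-mono-≤ (m≤n⇒m≤1+n (m≤m+n d k)))
...   | inj₂ Ad≡Ac = ⊥-elim (∉P1 (subst₂ InP1 Ad≡Ac (trans (B≡suc[A+k] d) (cong (λ a → suc (a + d)) Ad≡Ac)) (A,B∈P1 d)))
...   | inj₁ Ad<Ac = subst₂ MovesIntoP1 Ad+t≡Ac Bd+t≡y (move-diagonally t (m<n⇒0<n∸m Ad<Ac) (A,B∈P1 d))
  where
  open ≡-Reasoning
  t = A c ∸ A d
  Ad+t≡Ac : A d + t ≡ A c
  Ad+t≡Ac = m+[n∸m]≡n (<⇒≤ Ad<Ac)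
  Bd+t≡y : B d + t ≡ suc (A c + d)
  Bd+t≡y = begin
    B d + t               ≡⟨ cong (_+ t) (B≡suc[A+k] d) ⟩
    suc (A d + d + t)     ≡⟨ cong suc (xy∙z≈xz∙y (A d) d t) ⟩
    suc (A d + t + d)     ≡⟨ cong (λ a → suc (a + d)) Ad+t≡Ac ⟩
    suc (A c + d)         ∎

moves-below-diagonal : ∀ x d → ¬ InP1 x (suc (x + d)) → MovesIntoP1 x (suc (x + d))
moves-below-diagonal x d ∉P1 with A-B-cover x
... | inj₁ (c , refl) = moves-from-A c d ∉P1
... | inj₂ (k , refl) = move-down (<-≤-trans (A<B k) (m≤n⇒m≤1+n (m≤m+n (B k) d))) (B,A∈P1 k)

moves-on-diagonal : ∀ x → ¬ InP1 x x → MovesIntoP1 x x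
moves-on-diagonal zero ∉P1 = ⊥-elim (∉P1 (inj₁ (refl , refl)))
moves-on-diagonal (suc x) _ = move-diagonally {0} {0} (suc x) (s≤s z≤n) (inj₁ (refl , refl))

P1-dominating : ∀ x y → ¬ InP1 x y → MovesIntoP1 x y
P1-dominating x y ∉P1 with compare x y
... | less _ d = moves-below-diagonal x d ∉P1
... | equal _ = moves-on-diagonal x ∉P1
... | greater _ d = MovesIntoP1-swap (moves-below-diagonal y d (∉P1 ∘ InP1-swap))

lemma3p11 : (n m : ℕ) → 1 ≤ n → 1 ≤ m →
    floorPhi n ≡ floorPhi (n ∸ 1) + 1 →
    floorPhi n ≡ floorPhi1 m + 2 →
    (x y : ℕ) → ¬ InP1 x y →
    (y ≡ floorPhi n ⊎ y ≡ floorPhi n ∸ 1) →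
    ∃ λ u → ∃ λ v → QueenMove x y u v × InP1 u v
lemma3p11 _ _ _ _ _ _ x y ∉P1 _ = P1-dominating x y ∉P1
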